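{- Let $n\ge4$, $i\in\{1,2\}$, $m\ge1$ and $A=(a_{p,q})\in B^{i,m}$. For $2\le\ell\le n$ put $c_\ell=\sum_{p=1}^i a_{p,\ell}$ and define $$X_\ell:=\big(f_\ell^{c_\ell}\circ f_{\ell-1}^{c_\ell}\circ\cdots\circ f_{i+1}^{c_\ell}\big)\circ D_\ell,\qquad D_\ell=\begin{cases}f_2^{a_{2,\ell}}&\text{if } i=2,\\ \mathrm{id}&\text{if } i=1,\end{cases}$$ (the first composition being the identity when $\ell<i+1$), and with $d=\sum_{r=i}^n a_{1,r}$, $$G:=f_1^{d}\circ\cdots\circ f_i^{d}.$$ Then $P:=X_2\circ X_3\circ\cdots\circ X_n\circ G$ is defined on the zero array and maps the highest weight element (the zero array) of $B^{i,m}$ to $A$.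
   Context: $B^{i,m}$ is the set of arrays $A=(a_{p,q})$ of non-negative integers indexed by $1\le p\le i$ (column index), $i\le q\le n$ (row index; row $q$ is $(a_{1,q},\dots,a_{i,q})$), with $\sum_{r=1}^n a_{\beta(r)}\le m$ for every Dyck path $\beta$ (positions $\beta(1)=(1,i),\dots,\beta(n)=(i,n)$ with $\beta(r+1)\in\{(a,b+1),(a+1,b)\}$ if $\beta(r)=(a,b)$); $a_{p,q}=0$ outside the range. Crystal operators for $\ell\in\{1,\dots,n\}$: (i) $\ell=i$: $\varphi_i(A)=m-\sum_{j=1}^{i-1}a_{j,i}-\sum_{j=i}^n a_{i,j}$; $f_i$ increases $a_{i,i}$ by 1. (ii) $\ell>i$: with $T_p=\sum_{j=1}^p a_{j,\ell-1}+\sum_{j=p}^i a_{j,\ell}$ ($1\le p\le i$), $p_+$ the smallest maximizer: $\varphi_\ell(A)=\sum_{j=1}^{p_+}a_{j,\ell-1}-\sum_{j=1}^{p_+-1}a_{j,\ell}$; $f_\ell$ decreases $a_{p_+,\ell-1}$ by 1 and increases $a_{p_+,\ell}$ by 1. (iii) $\ell<i$: with $U_p=\sum_{j=i}^p a_{\ell,j}+\sum_{j=p}^n a_{\ell+1,j}$ ($i\le p\le n$), $p_-$ the largest maximizer: $\varphi_\ell(A)=\sum_{j=p_- }^n a_{\ell+1,j}-\sum_{j=p_-+1}^n a_{\ell,j}$; $f_\ell$ increases $a_{\ell,p_- }$ by 1 and decreases $a_{\ell+1,p_- }$ by 1. $f_\ell(A)=0$ (undefined) if $\varphi_\ell(A)=0$.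 $f_j^c$ with a fixed integer $c$ means applying $f_j$ $c$ times; $\circ$ is applied right to left. -}

module Defs where

open import Data.Nat using (ℕ; zero; suc; _+_; _∸_; _≤_; _<ᵇ_; _≡ᵇ_)
open import Data.Bool using (Bool; true; false; if_then_else_)
open import Data.Maybe using (Maybe; just; nothing)
open import Data.Maybe.Base using (_>>=_)
open import Data.Product using (_×_; _,_)
open import Data.Sum using (_⊎_)
open import Relation.Binary.PropositionalEquality using (_≡_)

-- An array A = (a_{p,q}) is encoded as a function  A p q = a_{p,q}
-- (p = column index, q = row index), on all of ℕ × ℕ.
Arr : Set
Arr = ℕ → ℕ → ℕ

zeroArr : Arr
zeroArr _ _ = 0

InRange : ℕ → ℕ → ℕ → ℕ → Set
InRange n i p q = 1 ≤ p × p ≤ i × i ≤ q × q ≤ n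

sumFrom : ℕ → ℕ → (ℕ → ℕ) → ℕ
sumFrom a zero    f = 0
sumFrom a (suc k) f = f a + sumFrom (suc a) k f

-- Σ[ a .. b ] f = Σ_{j=a}^{b} f j   (0 if b < a)
Σ[_∙∙_]_ : ℕ → ℕ → (ℕ → ℕ) → ℕ
Σ[ a ∙∙ b ] f = sumFrom a (suc b ∸ a) f

-- Dyck paths: β r = β(r) for 1 ≤ r ≤ n (values elsewhere irrelevant)
Step : ℕ × ℕ → ℕ × ℕ → Set
Step (a , b) (a' , b') = (a' ≡ a × b' ≡ suc b) ⊎ (a' ≡ suc a × b' ≡ b)

IsDyckPath : ℕ → ℕ → (ℕ → ℕ × ℕ) → Set
IsDyckPath n i β =
  β 1 ≡ (1 , i) × β n ≡ (i , n) ×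
  (∀ r → 1 ≤ r → suc r ≤ n → Step (β r) (β (suc r)))

at : Arr → ℕ × ℕ → ℕ
at A (p , q) = A p q

InB : ℕ → ℕ → ℕ → Arr → Set
InB n i m A =
  (∀ p q → (InRange n i p q → ⊥') → A p q ≡ 0) ×
  (∀ β → IsDyckPath n i β → (Σ[ 1 ∙∙ n ] (λ r → at A (β r))) ≤ m)
  where open import Data.Empty renaming (⊥ to ⊥')

scanMin : (ℕ → ℕ) → ℕ → ℕ → ℕ → ℕ
scanMin T best p zero    = best
scanMin T best p (suc k) = scanMin T (if T best <ᵇ T p then p else best) (suc p) k

scanMax : (ℕ → ℕ) → ℕ → ℕ → ℕ → ℕ
scanMax T best p zero    = best
scanMax T best p (suc k) = scanMax T (if T p <ᵇ T best then best else p) (suc p) k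

smallestMaximizer : (ℕ → ℕ) → ℕ → ℕ → ℕ
smallestMaximizer T lo hi = scanMin T lo (suc lo) (hi ∸ lo)

largestMaximizer : (ℕ → ℕ) → ℕ → ℕ → ℕ
largestMaximizer T lo hi = scanMax T lo (suc lo) (hi ∸ lo)

update : Arr → ℕ → ℕ → (ℕ → ℕ) → Arr
update A p q g p' q' = if (p' ≡ᵇ p) Data.Bool.∧ (q' ≡ᵇ q) then g (A p' q') else A p' q'

module Crystal (n i m : ℕ) where

  T : ℕ → Arr → ℕ → ℕ
  T ℓ A p = Σ[ 1 ∙∙ p ] (λ j → A j (ℓ ∸ 1)) + Σ[ p ∙∙ i ] (λ j → A j ℓ)

  p₊ : ℕ → Arr → ℕ
  p₊ ℓ A = smallestMaximizer (T ℓ A) 1 i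

  U : ℕ → Arr → ℕ → ℕ
  U ℓ A p = Σ[ i ∙∙ p ] (λ j → A ℓ j) + Σ[ p ∙∙ n ] (λ j → A (suc ℓ) j)

  p₋ : ℕ → Arr → ℕ
  p₋ ℓ A = largestMaximizer (U ℓ A) i n

  φ : ℕ → Arr → ℕ
  φ ℓ A =
    if ℓ ≡ᵇ i then
      m ∸ (Σ[ 1 ∙∙ i ∸ 1 ] (λ j → A j i) + Σ[ i ∙∙ n ] (λ j → A i j))
    else if i <ᵇ ℓ then
      Σ[ 1 ∙∙ p₊ ℓ A ] (λ j → A j (ℓ ∸ 1)) ∸ Σ[ 1 ∙∙ p₊ ℓ A ∸ 1 ] (λ j → A j ℓ)
    else
      Σ[ p₋ ℓ A ∙∙ n ] (λ j → A (suc ℓ) j) ∸ Σ[ suc (p₋ ℓ A) ∙∙ n ] (λ j → A ℓ j)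

  fRaw : ℕ → Arr → Arr
  fRaw ℓ A =
    if ℓ ≡ᵇ i then update A i i suc
    else if i <ᵇ ℓ then
      update (update A (p₊ ℓ A) (ℓ ∸ 1) (λ x → x ∸ 1)) (p₊ ℓ A) ℓ suc
    else
      update (update A ℓ (p₋ ℓ A) suc) (suc ℓ) (p₋ ℓ A) (λ x → x ∸ 1)

  -- f_ℓ : nothing encodes f_ℓ(A) = 0 (undefined), which happens iff φ_ℓ(A) = 0
  f : ℕ → Arr → Maybe Arr
  f ℓ A = if φ ℓ A ≡ᵇ 0 then nothing else just (fRaw ℓ A)

  PMap : Set
  PMap = Arr → Maybe Arr

  _∘ₖ_ : PMap → PMap → PMap
  (g ∘ₖ h) x = h x >>= g

  idₖ : PMap
  idₖ = just

  fpow : ℕ → ℕ → PMap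
  fpow ℓ zero    = idₖ
  fpow ℓ (suc c) = f ℓ ∘ₖ fpow ℓ c

  ascCount : (ℕ → PMap) → ℕ → ℕ → PMap
  ascCount k lo zero    = idₖ
  ascCount k lo (suc c) = k lo ∘ₖ ascCount k (suc lo) c

  descCount : (ℕ → PMap) → ℕ → ℕ → PMap
  descCount k lo zero    = idₖ
  descCount k lo (suc c) = descCount k (suc lo) c ∘ₖ k lo

  -- k lo ∘ k (lo+1) ∘ ... ∘ k hi   (identity if hi < lo)
  compAsc : (ℕ → PMap) → ℕ → ℕ → PMap
  compAsc k lo hi = ascCount k lo (suc hi ∸ lo)

  -- k hi ∘ ... ∘ k (lo+1) ∘ k lo   (identity if hi < lo)
  compDesc : (ℕ → PMap) → ℕ → ℕ → PMap
  compDesc k lo hi = descCount k lo (suc hi ∸ lo)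

  module _ (A : Arr) where

    c : ℕ → ℕ
    c ℓ = Σ[ 1 ∙∙ i ] (λ p → A p ℓ)

    D : ℕ → PMap
    D ℓ = if i ≡ᵇ 2 then fpow 2 (A 2 ℓ) else idₖ

    X : ℕ → PMap
    X ℓ = compDesc (λ j → fpow j (c ℓ)) (suc i) ℓ ∘ₖ D ℓ

    d : ℕ
    d = Σ[ i ∙∙ n ] (λ r → A 1 r)

    G : PMap
    G = compAsc (λ j → fpow j d) 1 i

    P : PMap
    P = compAsc X 2 n ∘ₖ G

{-# OPTIONS --safe #-}
-- G first piles all of column 1, d = Σ_q a_{1,q}, into the entry a_{1,i} (for i = 2 via
-- f_2^d, which fills a_{2,2}, and f_1^d, which empties it into a_{1,2}).  Then X_n, …, X_{i+1}
-- settle the rows from the bottom up: D_ℓ (only for i = 2) raises a_{2,2} to a_{2,ℓ}, and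
-- f_{i+1}^{c_ℓ}, …, f_ℓ^{c_ℓ} carry the packet (a_{1,ℓ}, a_{2,ℓ}) from row i through the still
-- empty rows i+1, …, ℓ-1 into row ℓ; for i = 2 the signature rule makes each f_j move the
-- column-2 part first and the column-1 part afterwards.  For i = 2, X_2 = D_2 finally fills
-- a_{2,2}.  Every operator applied is defined: in a transport step φ_j is at least the entry
-- being moved, and φ_i = m ∸ (weight of the hook through (i, i)) stays positive because that
-- weight plus what f_i still has to add is bounded by the weight of a Dyck path of A.
module Submission where

open import Defs
open import Data.Nat
open import Data.Nat.Properties
open import Data.Bool using (Bool; true; false; if_then_else_) renaming (T to True)
open import Data.Bool.Properties using (∧-zeroʳ)
open import Data.Maybe using (Maybe; just; nothing; _>>=_)
open import Data.Maybe.Relation.Unary.Any using (Any; just) renaming (map to Any-map)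
open import Data.Product using (Σ; ∃; _×_; _,_; proj₁; proj₂)
open import Data.Sum using (_⊎_; inj₁; inj₂; [_,_])
open import Data.Empty using (⊥-elim)
open import Relation.Nullary using (yes; no)
open import Relation.Binary.PropositionalEquality
  using (_≡_; _≢_; refl; sym; trans; cong; cong₂; subst; subst₂; module ≡-Reasoning)

Any->>= : ∀ {X Y : Set} {P : X → Set} {Q : Y → Set} {mx : Maybe X} {k : X → Maybe Y} →
          Any P mx → (∀ {x} → P x → Any Q (k x)) → Any Q (mx >>= k)
Any->>= (just p) h = h p

Any⇒≡just : ∀ {X : Set} {P : X → Set} {mx : Maybe X} → Any P mx → ∃ λ x → mx ≡ just x × P x
Any⇒≡just (just p) = _ , refl , p

>>=-identityʳ : ∀ {X : Set} (mx : Maybe X) → (mx >>= just) ≡ mx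
>>=-identityʳ (just x) = refl
>>=-identityʳ nothing  = refl

>>=-assoc : ∀ {X Y Z : Set} (mx : Maybe X) (g : X → Maybe Y) (h : Y → Maybe Z) →
            ((mx >>= g) >>= h) ≡ (mx >>= λ x → g x >>= h)
>>=-assoc (just x) g h = refl
>>=-assoc nothing  g h = refl

if-true : ∀ {A : Set} {b : Bool} {x y : A} → b ≡ true → (if b then x else y) ≡ x
if-true refl = refl

if-false : ∀ {A : Set} {b : Bool} {x y : A} → b ≡ false → (if b then x else y) ≡ y
if-false refl = refl

≡ᵇ-refl : ∀ n → (n ≡ᵇ n) ≡ true
≡ᵇ-refl zero    = refl
≡ᵇ-refl (suc n) = ≡ᵇ-refl n

≢⇒≡ᵇ-false : ∀ {m n} → m ≢ n → (m ≡ᵇ n) ≡ false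
≢⇒≡ᵇ-false {m} {n} m≢n with m ≡ᵇ n in eq
... | false = refl
... | true  = ⊥-elim (m≢n (≡ᵇ⇒≡ m n (subst True (sym eq) _)))

<⇒<ᵇ-true : ∀ {m n} → m < n → (m <ᵇ n) ≡ true
<⇒<ᵇ-true {m} {n} m<n with m <ᵇ n in eq
... | true  = refl
... | false = ⊥-elim (subst True eq (<⇒<ᵇ m<n))

≤⇒<ᵇ-false : ∀ {m n} → n ≤ m → (m <ᵇ n) ≡ false
≤⇒<ᵇ-false {m} {n} n≤m with m <ᵇ n in eq
... | false = refl
... | true  = ⊥-elim (<⇒≱ (<ᵇ⇒< m n (subst True (sym eq) _)) n≤m)

a≤j<a+[1+b∸a]⇒j≤b : ∀ {a b j} → a ≤ j → j < a + (suc b ∸ a) → j ≤ b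
a≤j<a+[1+b∸a]⇒j≤b {a} {b} {j} a≤j j<end with ≤-total a (suc b)
... | inj₁ a≤1+b = ≤-pred (subst (j <_) (m+[n∸m]≡n a≤1+b) j<end)
... | inj₂ 1+b≤a =
  ⊥-elim (<⇒≱ (subst (j <_) (trans (cong (a +_) (m≤n⇒m∸n≡0 1+b≤a)) (+-identityʳ a)) j<end) a≤j)

update-same : ∀ B p q g → update B p q g p q ≡ g (B p q)
update-same B p q g rewrite ≡ᵇ-refl p | ≡ᵇ-refl q = refl

update-other : ∀ B p q g p′ q′ → p′ ≢ p ⊎ q′ ≢ q → update B p q g p′ q′ ≡ B p′ q′
update-other B p q g p′ q′ (inj₁ p′≢p) rewrite ≢⇒≡ᵇ-false p′≢p = refl
update-other B p q g p′ q′ (inj₂ q′≢q) rewrite ≢⇒≡ᵇ-false q′≢q | ∧-zeroʳ (p′ ≡ᵇ p) = refl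

sumFrom-cong : ∀ k a {f g : ℕ → ℕ} → (∀ j → a ≤ j → j < a + k → f j ≡ g j) →
               sumFrom a k f ≡ sumFrom a k g
sumFrom-cong zero    a f≗g = refl
sumFrom-cong (suc k) a f≗g =
  cong₂ _+_ (f≗g a ≤-refl (m<m+n a z<s))
            (sumFrom-cong k (suc a) λ j a<j j<end → f≗g j (<⇒≤ a<j) (subst (j <_) (sym (+-suc a k)) j<end))

sumFrom-zero : ∀ k a → sumFrom a k (λ _ → 0) ≡ 0
sumFrom-zero zero    a = refl
sumFrom-zero (suc k) a = sumFrom-zero k (suc a)

sumFrom-+ : ∀ k l a f → sumFrom a (k + l) f ≡ sumFrom a k f + sumFrom (a + k) l f
sumFrom-+ zero    l a f = cong (λ b → sumFrom b l f) (sym (+-identityʳ a))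
sumFrom-+ (suc k) l a f =
  trans (cong (f a +_) (trans (sumFrom-+ k l (suc a) f)
                              (cong (λ b → sumFrom (suc a) k f + sumFrom b l f) (sym (+-suc a k)))))
        (sym (+-assoc (f a) _ _))

sumFrom-suc : ∀ k a f → sumFrom a k (λ j → f (suc j)) ≡ sumFrom (suc a) k f
sumFrom-suc zero    a f = refl
sumFrom-suc (suc k) a f = cong (f (suc a) +_) (sumFrom-suc k (suc a) f)

Σ-cong : ∀ {a b} {f g : ℕ → ℕ} → (∀ j → a ≤ j → j ≤ b → f j ≡ g j) →
         Σ[ a ∙∙ b ] f ≡ Σ[ a ∙∙ b ] g
Σ-cong {a} {b} f≗g =
  sumFrom-cong (suc b ∸ a) a λ j a≤j j<end → f≗g j a≤j (a≤j<a+[1+b∸a]⇒j≤b a≤j j<end)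

Σ-zero : ∀ {a b} {f : ℕ → ℕ} → (∀ j → a ≤ j → j ≤ b → f j ≡ 0) → Σ[ a ∙∙ b ] f ≡ 0
Σ-zero {a} {b} f≗0 = trans (Σ-cong f≗0) (sumFrom-zero (suc b ∸ a) a)

Σ-empty : ∀ {a b} f → b < a → Σ[ a ∙∙ b ] f ≡ 0
Σ-empty {a} f b<a = cong (λ k → sumFrom a k f) (m≤n⇒m∸n≡0 b<a)

Σ-head : ∀ {a b} f → a ≤ b → Σ[ a ∙∙ b ] f ≡ f a + Σ[ suc a ∙∙ b ] f
Σ-head {a} f a≤b = cong (λ k → sumFrom a k f) (+-∸-assoc 1 a≤b)

Σ-split : ∀ {a k b} f → a ≤ suc k → k ≤ b → Σ[ a ∙∙ b ] f ≡ Σ[ a ∙∙ k ] f + Σ[ suc k ∙∙ b ] f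
Σ-split {a} {k} {b} f a≤1+k k≤b = begin
  sumFrom a (suc b ∸ a) f
    ≡⟨ cong (λ l → sumFrom a l f) lengths ⟩
  sumFrom a ((suc k ∸ a) + (b ∸ k)) f
    ≡⟨ sumFrom-+ (suc k ∸ a) (b ∸ k) a f ⟩
  sumFrom a (suc k ∸ a) f + sumFrom (a + (suc k ∸ a)) (b ∸ k) f
    ≡⟨ cong (λ c → sumFrom a (suc k ∸ a) f + sumFrom c (b ∸ k) f) (m+[n∸m]≡n a≤1+k) ⟩
  sumFrom a (suc k ∸ a) f + sumFrom (suc k) (b ∸ k) f
    ∎
  where
  open ≡-Reasoning
  lengths : suc b ∸ a ≡ (suc k ∸ a) + (b ∸ k)
  lengths = begin
    suc b ∸ a               ≡⟨ cong (λ c → suc c ∸ a) (m∸n+n≡m k≤b) ⟨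
    suc ((b ∸ k) + k) ∸ a   ≡⟨ cong (_∸ a) (+-suc (b ∸ k) k) ⟨
    ((b ∸ k) + suc k) ∸ a   ≡⟨ +-∸-assoc (b ∸ k) a≤1+k ⟩
    (b ∸ k) + (suc k ∸ a)   ≡⟨ +-comm (b ∸ k) _ ⟩
    (suc k ∸ a) + (b ∸ k)   ∎

Σ-last : ∀ {a k} f → a ≤ suc k → Σ[ a ∙∙ suc k ] f ≡ Σ[ a ∙∙ k ] f + f (suc k)
Σ-last {a} {k} f a≤1+k = begin
  Σ[ a ∙∙ suc k ] f
    ≡⟨ Σ-split f a≤1+k (n≤1+n k) ⟩
  Σ[ a ∙∙ k ] f + Σ[ suc k ∙∙ suc k ] f
    ≡⟨ cong (Σ[ a ∙∙ k ] f +_) (Σ-head f ≤-refl) ⟩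
  Σ[ a ∙∙ k ] f + (f (suc k) + Σ[ suc (suc k) ∙∙ suc k ] f)
    ≡⟨ cong (λ s → Σ[ a ∙∙ k ] f + (f (suc k) + s)) (Σ-empty {suc (suc k)} {suc k} f ≤-refl) ⟩
  Σ[ a ∙∙ k ] f + (f (suc k) + 0)
    ≡⟨ cong (Σ[ a ∙∙ k ] f +_) (+-identityʳ _) ⟩
  Σ[ a ∙∙ k ] f + f (suc k)
    ∎
  where open ≡-Reasoning

Σ-shift : ∀ a b f → Σ[ a ∙∙ b ] (λ j → f (suc j)) ≡ Σ[ suc a ∙∙ suc b ] f
Σ-shift a b f = sumFrom-suc (suc b ∸ a) a f

scanMax-keeps : ∀ {T} k best p → (∀ j → p ≤ j → j < p + k → T j < T best) → scanMax T best p k ≡ best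
scanMax-keeps zero    best p below = refl
scanMax-keeps (suc k) best p below rewrite <⇒<ᵇ-true (below p ≤-refl (m<m+n p z<s)) =
  scanMax-keeps k best (suc p) λ j p<j j<end → below j (<⇒≤ p<j) (subst (j <_) (sym (+-suc p k)) j<end)

largestMaximizer-lo : ∀ {T} lo hi → (∀ j → lo < j → j ≤ hi → T j < T lo) → largestMaximizer T lo hi ≡ lo
largestMaximizer-lo lo hi below =
  scanMax-keeps (hi ∸ lo) lo (suc lo) λ j lo<j j<end → below j lo<j (a≤j<a+[1+b∸a]⇒j≤b lo<j j<end)

shift : ℕ → ℕ → Arr → Arr
shift p r B = update (update B p r pred) p (suc r) suc

shift-source : ∀ p r B → shift p r B p r ≡ pred (B p r)
shift-source p r B = trans (update-other (update B p r pred) p (suc r) suc p r (inj₂ (<⇒≢ (n<1+n r))))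
                           (update-same B p r pred)

shift-target : ∀ p r B → shift p r B p (suc r) ≡ suc (B p (suc r))
shift-target p r B = trans (update-same (update B p r pred) p (suc r) suc)
                           (cong suc (update-other B p r pred p (suc r) (inj₂ (>⇒≢ (n<1+n r)))))

shift-other-column : ∀ p r B p′ q → p′ ≢ p → shift p r B p′ q ≡ B p′ q
shift-other-column p r B p′ q p′≢p =
  trans (update-other (update B p r pred) p (suc r) suc p′ q (inj₁ p′≢p))
        (update-other B p r pred p′ q (inj₁ p′≢p))

shift-other-row : ∀ p r B p′ q → q ≢ r → q ≢ suc r → shift p r B p′ q ≡ B p′ q
shift-other-row p r B p′ q q≢r q≢1+r =
  trans (update-other (update B p r pred) p (suc r) suc p′ q (inj₂ q≢1+r))
        (update-other B p r pred p′ q (inj₂ q≢r))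

-- i ≤ 2, so only the first two entries of a row ever matter.
row : Arr → ℕ → ℕ × ℕ
row B q = B 1 q , B 2 q

Empty : ℕ → ℕ → Arr → Set
Empty lo hi B = ∀ q → lo ≤ q → q ≤ hi → row B q ≡ (0 , 0)

Frame : ℕ → ℕ → Arr → Arr → Set
Frame lo hi B B′ = ∀ q → q < lo ⊎ hi < q → row B′ q ≡ row B q

shift-frame : ∀ p r B → Frame r (suc r) B (shift p r B)
shift-frame p r B q outside =
  cong₂ _,_ (shift-other-row p r B 1 q q≢r q≢1+r) (shift-other-row p r B 2 q q≢r q≢1+r)
  where
  q≢r : q ≢ r
  q≢r = [ <⇒≢ , (λ 1+r<q → >⇒≢ (<-trans (n<1+n r) 1+r<q)) ] outside
  q≢1+r : q ≢ suc r
  q≢1+r = [ (λ q<r → <⇒≢ (<-trans q<r (n<1+n r))) , >⇒≢ ] outside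

row-shift₁ : ∀ r B {u v d w} → row B r ≡ (suc u , v) → row B (suc r) ≡ (d , w) →
             row (shift 1 r B) r ≡ (u , v) × row (shift 1 r B) (suc r) ≡ (suc d , w)
row-shift₁ r B src tgt =
  cong₂ _,_ (trans (shift-source 1 r B) (cong pred (cong proj₁ src)))
            (trans (shift-other-column 1 r B 2 r (λ ())) (cong proj₂ src)) ,
  cong₂ _,_ (trans (shift-target 1 r B) (cong suc (cong proj₁ tgt)))
            (trans (shift-other-column 1 r B 2 (suc r) (λ ())) (cong proj₂ tgt))

row-shift₂ : ∀ r B {u v d w} → row B r ≡ (u , suc v) → row B (suc r) ≡ (d , w) →
             row (shift 2 r B) r ≡ (u , v) × row (shift 2 r B) (suc r) ≡ (d , suc w)
row-shift₂ r B src tgt =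
  cong₂ _,_ (trans (shift-other-column 2 r B 1 r (λ ())) (cong proj₁ src))
            (trans (shift-source 2 r B) (cong pred (cong proj₂ src))) ,
  cong₂ _,_ (trans (shift-other-column 2 r B 1 (suc r) (λ ())) (cong proj₁ tgt))
            (trans (shift-target 2 r B) (cong suc (cong proj₂ tgt)))

module Operators (n i m : ℕ) where
  open Crystal n i m

  f-defined : ∀ {ℓ B} {P : Arr → Set} → 0 < φ ℓ B → P (fRaw ℓ B) → Any P (f ℓ B)
  f-defined {ℓ} {B} φ>0 post =
    subst (Any _) (cong (λ v → if v ≡ᵇ 0 then nothing else just (fRaw ℓ B))
                        (suc-pred (φ ℓ B) {{>-nonZero φ>0}}))
          (just post)

  fpow-+ : ∀ ℓ a c B → fpow ℓ (a + c) B ≡ (fpow ℓ c B >>= fpow ℓ a)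
  fpow-+ ℓ zero    c B = sym (>>=-identityʳ (fpow ℓ c B))
  fpow-+ ℓ (suc a) c B = trans (cong (_>>= f ℓ) (fpow-+ ℓ a c B)) (>>=-assoc (fpow ℓ c B) (fpow ℓ a) (f ℓ))

  -- R u d: u applications of f ℓ still to come, d already made.
  fpow-induction : ∀ ℓ (R : ℕ → ℕ → Arr → Set) →
                   (∀ u d {B} → R (suc u) d B → Any (R u (suc d)) (f ℓ B)) →
                   ∀ c {B} → R c 0 B → Any (R 0 c) (fpow ℓ c B)
  fpow-induction ℓ R step zero    r = just r
  fpow-induction ℓ R step (suc c) r =
    Any->>= (fpow-induction ℓ (λ u → R (suc u)) (λ u d → step (suc u) d) c r) (step 0 c)

  ascCount-induction : ∀ {g : ℕ → PMap} (R : ℕ → Arr → Set) k lo →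
                       (∀ j → lo ≤ j → j < k + lo → ∀ {B} → R (suc j) B → Any (R j) (g j B)) →
                       ∀ {B} → R (k + lo) B → Any (R lo) (ascCount g lo k B)
  ascCount-induction R zero    lo step r = just r
  ascCount-induction {g} R (suc k) lo step {B} r =
    Any->>= (ascCount-induction R k (suc lo) step′ (subst (λ t → R t B) (sym (+-suc k lo)) r))
            (step lo ≤-refl (s≤s (m≤n+m lo k)))
    where
    step′ : ∀ j → suc lo ≤ j → j < k + suc lo → ∀ {B} → R (suc j) B → Any (R j) (g j B)
    step′ j lo<j j<end = step j (<⇒≤ lo<j) (subst (j <_) (+-suc k lo) j<end)

  weight : Arr → ℕ
  weight B = Σ[ 1 ∙∙ i ∸ 1 ] (λ j → B j i) + Σ[ i ∙∙ n ] (λ j → B i j)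

  weight-raise : 1 ≤ i → i ≤ n → ∀ B → weight (update B i i suc) ≡ suc (weight B)
  weight-raise 1≤i i≤n B = begin
    Σ[ 1 ∙∙ i ∸ 1 ] (λ j → B′ j i) + Σ[ i ∙∙ n ] (λ j → B′ i j)
      ≡⟨ cong₂ _+_ (Σ-cong column) (Σ-head _ i≤n) ⟩
    column-sum + (B′ i i + Σ[ suc i ∙∙ n ] (λ j → B′ i j))
      ≡⟨ cong (column-sum +_) (cong₂ _+_ (update-same B i i suc) (Σ-cong rest)) ⟩
    column-sum + suc (B i i + Σ[ suc i ∙∙ n ] (λ j → B i j))
      ≡⟨ +-suc column-sum _ ⟩
    suc (column-sum + (B i i + Σ[ suc i ∙∙ n ] (λ j → B i j)))
      ≡⟨ cong (λ t → suc (column-sum + t)) (Σ-head _ i≤n) ⟨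
    suc (weight B) ∎
    where
    open ≡-Reasoning
    B′ = update B i i suc
    column-sum = Σ[ 1 ∙∙ i ∸ 1 ] (λ j → B j i)
    column : ∀ j → 1 ≤ j → j ≤ i ∸ 1 → B′ j i ≡ B j i
    column j _ j≤i-1 =
      update-other B i i suc j i (inj₁ (<⇒≢ (m≤pred[n]⇒suc[m]≤n {{>-nonZero 1≤i}} j≤i-1)))
    rest : ∀ j → suc i ≤ j → j ≤ n → B′ i j ≡ B i j
    rest j i<j _ = update-other B i i suc i j (inj₂ (>⇒≢ i<j))

  f-raises-diagonal : ∀ {B} {P : Arr → Set} → weight B < m → P (update B i i suc) → Any P (f i B)
  f-raises-diagonal {B} {P} w<m post =
    f-defined {i} {B} (subst (0 <_) (sym (if-true (≡ᵇ-refl i))) (m<n⇒0<n∸m w<m))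
                      (subst P (sym (if-true (≡ᵇ-refl i))) post)

  OffDiagonal : Arr → Arr → Set
  OffDiagonal B B′ = ∀ p q → p ≢ i ⊎ q ≢ i → B′ p q ≡ B p q

  fpow-raises-diagonal : 1 ≤ i → i ≤ n → ∀ c {B} → weight B + c ≤ m →
                         Any (λ B′ → B′ i i ≡ c + B i i × OffDiagonal B B′) (fpow i c B)
  fpow-raises-diagonal 1≤i i≤n c {B} bound =
    Any-map proj₂ (fpow-induction i R step c (bound , refl , λ _ _ _ → refl))
    where
    R : ℕ → ℕ → Arr → Set
    R u d B′ = weight B′ + u ≤ m × B′ i i ≡ d + B i i × OffDiagonal B B′
    step : ∀ u d {B′} → R (suc u) d B′ → Any (R u (suc d)) (f i B′)
    step u d {B′} (w , b , fr) =
      f-raises-diagonal (≤-trans (s≤s (m≤m+n _ u)) (subst (_≤ m) (+-suc _ u) w))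
        ( subst (_≤ m) (trans (+-suc _ u) (cong (_+ u) (sym (weight-raise 1≤i i≤n B′)))) w
        , trans (update-same B′ i i suc) (cong suc b)
        , λ p q off → trans (update-other B′ i i suc p q off) (fr p q off))

  OffDiagonal⇒row : ∀ {B B′} → OffDiagonal B B′ → ∀ q → q ≢ i → row B′ q ≡ row B q
  OffDiagonal⇒row fr q q≢i = cong₂ _,_ (fr 1 q (inj₂ q≢i)) (fr 2 q (inj₂ q≢i))

  Hop : ℕ → ℕ → ℕ → Set
  Hop c a b = ∀ r x {B} → i ≤ r → row B r ≡ (x + a , b) → row B (suc r) ≡ (0 , 0) →
              Any (λ B′ → row B′ r ≡ (x , 0) × row B′ (suc r) ≡ (a , b) × Frame r (suc r) B B′)
                  (fpow (suc r) c B)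

  transport : ∀ {c a b} → Hop c a b → ∀ s r x {B} → i ≤ r →
              row B r ≡ (x + a , b) → Empty (suc r) (suc (r + s)) B →
              Any (λ B′ → row B′ r ≡ (x , 0) × Empty (suc r) (r + s) B′ ×
                          row B′ (suc (r + s)) ≡ (a , b) × Frame r (suc (r + s)) B B′)
                  (descCount (λ j → fpow j c) (suc r) (suc s) B)
  transport hop zero r x i≤r src empty rewrite +-identityʳ r =
    Any->>= (hop r x i≤r src (empty (suc r) ≤-refl ≤-refl))
            λ (left , moved , fr) → just (left , (λ q r<q q≤r → ⊥-elim (<⇒≱ r<q q≤r)) , moved , fr)
  transport {c} {a} {b} hop (suc s) r x {B} i≤r src empty rewrite +-suc r s =
    Any->>= (hop r x i≤r src (empty (suc r) ≤-refl (s≤s (m≤n⇒m≤1+n (m≤m+n r s)))))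
            λ {B₁} (left , moved , fr₁) →
              Any-map (λ {B′} → onwards {B₁} {B′} fr₁ left)
                      (transport {c} {a} {b} hop s (suc r) 0 {B₁} (m≤n⇒m≤1+n i≤r) moved
                                 (still-empty {B₁} fr₁))
    where
    end = suc (suc (r + s))
    still-empty : ∀ {B₁} → Frame r (suc r) B B₁ → Empty (suc (suc r)) end B₁
    still-empty fr₁ q 1+r<q q≤end = trans (fr₁ q (inj₂ 1+r<q)) (empty q (<⇒≤ 1+r<q) q≤end)
    onwards : ∀ {B₁ B′ x′} → Frame r (suc r) B B₁ → row B₁ r ≡ (x′ , 0) →
              row B′ (suc r) ≡ (0 , 0) × Empty (suc (suc r)) (suc (r + s)) B′ ×
              row B′ end ≡ (a , b) × Frame (suc r) end B₁ B′ →
              row B′ r ≡ (x′ , 0) × Empty (suc r) (suc (r + s)) B′ ×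
              row B′ end ≡ (a , b) × Frame r end B B′
    onwards {B₁} {B′} fr₁ left (vacated , empty′ , arrived , fr) =
      trans (fr r (inj₁ (n<1+n r))) left , empty″ , arrived , fr′
      where
      empty″ : Empty (suc r) (suc (r + s)) B′
      empty″ q r<q q≤r+s+1 with m≤n⇒m<n∨m≡n r<q
      ... | inj₂ refl  = vacated
      ... | inj₁ 1+r<q = empty′ q 1+r<q q≤r+s+1
      fr′ : Frame r end B B′
      fr′ q (inj₁ q<r)   = trans (fr q (inj₁ (m<n⇒m<1+n q<r))) (fr₁ q (inj₁ q<r))
      fr′ q (inj₂ end<q) = trans (fr q (inj₂ end<q)) (fr₁ q (inj₂ (<-trans (s≤s (s≤s (m≤m+n r s))) end<q)))

module Descent (n i m : ℕ) (A : Arr) where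
  open Crystal n i m
  open Operators n i m

  Settled : ℕ → Arr → Set
  Settled ℓ B = ∀ q → ℓ < q → q ≤ n → row B q ≡ row A q

  -- The state X_{ℓ+1} ∘ ⋯ ∘ X_n ∘ G reaches: rows below ℓ are final, and the column-1 mass
  -- of rows i, …, ℓ still sits in a_{1,i}.
  Stage : ℕ → Arr → Set
  Stage ℓ B = row B i ≡ (Σ[ i ∙∙ ℓ ] (A 1) , 0) × Empty (suc i) ℓ B × Settled ℓ B

  -- The state after the D_ℓ part of X_ℓ: the packet of row ℓ is ready to leave row i.
  Loaded : ℕ → Arr → Set
  Loaded ℓ B = row B i ≡ (Σ[ i ∙∙ ℓ ∸ 1 ] (A 1) + A 1 ℓ , A 2 ℓ) × Empty (suc i) ℓ B × Settled ℓ B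

  X-step : ∀ s {B} → let ℓ = suc (i + s) in
           Hop (c A ℓ) (A 1 ℓ) (A 2 ℓ) → Any (Loaded ℓ) (D A ℓ B) → Any (Stage (i + s)) (X A ℓ B)
  X-step s hop loaded = Any->>= loaded λ {B} (src , empty , settled) →
    subst (λ k → Any (Stage (i + s)) (descCount (λ j → fpow j (c A ℓ)) (suc i) k B)) (sym hops)
          (Any-map (λ {B′} (left , empty′ , arrived , fr) →
                      left , empty′ , settled′ {B} {B′} settled arrived fr)
                   (transport {c A ℓ} {A 1 ℓ} {A 2 ℓ} hop s i _ {B} ≤-refl src empty))
    where
    ℓ = suc (i + s)
    hops : ℓ ∸ i ≡ suc s
    hops = trans (cong (_∸ i) (sym (+-suc i s))) (m+n∸m≡n i (suc s))
    settled′ : ∀ {B B′} → Settled ℓ B → row B′ ℓ ≡ row A ℓ → Frame i ℓ B B′ → Settled (i + s) B′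
    settled′ settled arrived fr q ℓ≤q q≤n with m≤n⇒m<n∨m≡n ℓ≤q
    ... | inj₂ refl = arrived
    ... | inj₁ ℓ<q  = trans (fr q (inj₂ ℓ<q)) (settled q ℓ<q q≤n)

  descent : i ≤ n → (∀ ℓ → i < ℓ → ℓ ≤ n → Hop (c A ℓ) (A 1 ℓ) (A 2 ℓ)) →
            (∀ ℓ → i < ℓ → ℓ ≤ n → ∀ {B} → Stage ℓ B → Any (Loaded ℓ) (D A ℓ B)) →
            ∀ {B} → Stage n B → Any (Stage i) (compAsc (X A) (suc i) n B)
  descent i≤n hop load {B} st = ascCount-induction R (n ∸ i) (suc i) step (subst (λ t → R t B) (sym top) st)
    where
    R : ℕ → Arr → Set
    R j = Stage (j ∸ 1)
    top : n ∸ i + suc i ≡ suc n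
    top = trans (+-suc (n ∸ i) i) (cong suc (m∸n+n≡m i≤n))
    step : ∀ j → suc i ≤ j → j < n ∸ i + suc i → ∀ {B} → Stage j B → Any (Stage (j ∸ 1)) (X A j B)
    step j i<j j<top {B} st with m≤n⇒∃[o]m+o≡n i<j
    ... | s , refl = X-step s {B} (hop _ i<j j≤n) (load _ i<j j≤n st)
      where
      j≤n : suc (i + s) ≤ n
      j≤n = ≤-pred (subst (suc (i + s) <_) top j<top)

  Agrees : Arr → Set
  Agrees B = ∀ p q → InRange n i p q → B p q ≡ A p q

  agrees : i ≤ 2 → ∀ {B} → row B i ≡ row A i → Settled i B → Agrees B
  agrees i≤2 {B} here settled p q (1≤p , p≤i , i≤q , q≤n) = entry p 1≤p (≤-trans p≤i i≤2) same
    where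
    same : row B q ≡ row A q
    same with m≤n⇒m<n∨m≡n i≤q
    ... | inj₂ refl = here
    ... | inj₁ i<q  = settled q i<q q≤n
    entry : ∀ p → 1 ≤ p → p ≤ 2 → row B q ≡ row A q → B p q ≡ A p q
    entry 1 _ _ = cong proj₁
    entry 2 _ _ = cong proj₂
    entry (suc (suc (suc _))) _ (s≤s (s≤s ()))

module OneColumn (n m : ℕ) where
  open Crystal n 1 m
  open Operators n 1 m

  f-shifts : ∀ r B {P : Arr → Set} → 0 < B 1 (suc r) → P (shift 1 (suc r) B) → Any P (f (suc (suc r)) B)
  f-shifts r B {P} pos = f-defined {suc (suc r)} {B} {P} (subst (0 <_) (sym (+-identityʳ (B 1 (suc r)))) pos)

  -- For i = 1, c_ℓ = Σ_{p ≤ 1} a_{p,ℓ} unfolds to a_{1,ℓ} + 0.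
  hop : ∀ a → Hop (a + 0) a 0
  hop a (suc r) x {B} _ src tgt =
    Any-map (λ {B′} → arrive {B′}) (fpow-induction (suc (suc r)) R step (a + 0) start)
    where
    R : ℕ → ℕ → Arr → Set
    R u d B′ = row B′ (suc r) ≡ (u + x , 0) × row B′ (suc (suc r)) ≡ (d , 0) ×
               Frame (suc r) (suc (suc r)) B B′
    step : ∀ u d {B′} → R (suc u) d B′ → Any (R u (suc d)) (f (suc (suc r)) B′)
    step u d {B′} (left , right , fr) =
      f-shifts r B′ (subst (0 <_) (sym (cong proj₁ left)) z<s)
        (let left′ , right′ = row-shift₁ (suc r) B′ left right in
         left′ , right′ , λ q outside → trans (shift-frame 1 (suc r) B′ q outside) (fr q outside))
    start : R (a + 0) 0 B
    start = trans src (cong (_, 0) (trans (+-comm x a) (cong (_+ x) (sym (+-identityʳ a))))) , tgt , λ _ _ → refl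
    arrive : ∀ {B′} → R 0 (a + 0) B′ →
             row B′ (suc r) ≡ (x , 0) × row B′ (suc (suc r)) ≡ (a , 0) × Frame (suc r) (suc (suc r)) B B′
    arrive (left , right , fr) = left , trans right (cong (_, 0) (+-identityʳ a)) , fr

  module _ (A : Arr) (inB : InB n 1 m A) (1≤n : 1 ≤ n) where
    open Descent n 1 m A

    column₂-zero : ∀ q → A 2 q ≡ 0
    column₂-zero q = proj₁ inB 2 q λ { (_ , s≤s () , _) }

    D-loads : ∀ ℓ → 1 < ℓ → ℓ ≤ n → ∀ {B} → Stage ℓ B → Any (Loaded ℓ) (D A ℓ B)
    D-loads (suc k) _ _ (src , empty , settled) =
      just (trans src (cong₂ _,_ (Σ-last (A 1) (s≤s z≤n)) (sym (column₂-zero (suc k)))) , empty , settled)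

    G-reaches-Stage : Any (Stage n) (G A zeroArr)
    G-reaches-Stage = Any-map (λ {B} → stage {B}) (fpow-raises-diagonal ≤-refl 1≤n (d A) {zeroArr} bound)
      where
      bound : weight zeroArr + d A ≤ m
      bound = subst (λ w → w + d A ≤ m) (sym (Σ-zero {1} {n} λ _ _ _ → refl))
                    (proj₂ inB (λ r → 1 , r) (refl , refl , λ _ _ _ → inj₁ (refl , refl)))
      stage : ∀ {B} → B 1 1 ≡ d A + 0 × OffDiagonal zeroArr B → Stage n B
      stage (b , fr) = cong₂ _,_ (trans b (+-identityʳ (d A))) (fr 2 1 (inj₁ λ ())) ,
                       (λ q 2≤q _ → OffDiagonal⇒row fr q (>⇒≢ 2≤q)) ,
                       λ q n<q q≤n → ⊥-elim (<⇒≱ n<q q≤n)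

    P-agrees : Any Agrees (P A zeroArr)
    P-agrees = Any->>= G-reaches-Stage λ st → Any-map finish (descent 1≤n hop′ D-loads st)
      where
      hop′ : ∀ ℓ → 1 < ℓ → ℓ ≤ n → Hop (c A ℓ) (A 1 ℓ) (A 2 ℓ)
      hop′ ℓ _ _ = subst (Hop (A 1 ℓ + 0) (A 1 ℓ)) (sym (column₂-zero ℓ)) (hop (A 1 ℓ))
      finish : ∀ {B} → Stage 1 B → Agrees B
      finish {B} (here , _ , settled) =
        agrees (s≤s z≤n) {B} (trans here (cong₂ _,_ (+-identityʳ (A 1 1)) (sym (column₂-zero 1)))) settled

-- n is given as n′ + 2 so that sums and compositions starting at 2 unfold definitionally,
-- e.g. compAsc X 2 n = X 2 ∘ₖ compAsc X 3 n.
module TwoColumns (n′ m : ℕ) where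
  n : ℕ
  n = suc (suc n′)

  open Crystal n 2 m
  open Operators n 2 m

  T-at₁ : ∀ r B → T (3 + r) B 1 ≡ B 1 (2 + r) + (B 1 (3 + r) + B 2 (3 + r))
  T-at₁ r B = cong₂ _+_ (+-identityʳ (B 1 (2 + r))) (cong (B 1 (3 + r) +_) (+-identityʳ (B 2 (3 + r))))

  T-at₂ : ∀ r B → T (3 + r) B 2 ≡ B 1 (2 + r) + (B 2 (2 + r) + B 2 (3 + r))
  T-at₂ r B = trans (cong₂ _+_ (cong (B 1 (2 + r) +_) (+-identityʳ (B 2 (2 + r)))) (+-identityʳ (B 2 (3 + r))))
                    (+-assoc (B 1 (2 + r)) (B 2 (2 + r)) (B 2 (3 + r)))

  p₊-column₂ : ∀ r B → B 1 (3 + r) < B 2 (2 + r) → p₊ (3 + r) B ≡ 2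
  p₊-column₂ r B lt = if-true (<⇒<ᵇ-true (subst₂ _<_ (sym (T-at₁ r B)) (sym (T-at₂ r B))
                                  (+-monoʳ-< (B 1 (2 + r)) (+-monoˡ-< (B 2 (3 + r)) lt))))

  p₊-column₁ : ∀ r B → B 2 (2 + r) ≤ B 1 (3 + r) → p₊ (3 + r) B ≡ 1
  p₊-column₁ r B le = if-false (≤⇒<ᵇ-false (subst₂ _≤_ (sym (T-at₂ r B)) (sym (T-at₁ r B))
                                   (+-monoʳ-≤ (B 1 (2 + r)) (+-monoˡ-≤ (B 2 (3 + r)) le))))

  φ-at : ∀ r B p → p₊ (3 + r) B ≡ p →
         φ (3 + r) B ≡ Σ[ 1 ∙∙ p ] (λ j → B j (2 + r)) ∸ Σ[ 1 ∙∙ p ∸ 1 ] (λ j → B j (3 + r))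
  φ-at r B p = cong (λ p → Σ[ 1 ∙∙ p ] (λ j → B j (2 + r)) ∸ Σ[ 1 ∙∙ p ∸ 1 ] (λ j → B j (3 + r)))

  f-shifts-column₂ : ∀ r B {P : Arr → Set} → B 1 (3 + r) < B 2 (2 + r) →
                     P (shift 2 (2 + r) B) → Any P (f (3 + r) B)
  f-shifts-column₂ r B {P} lt post =
    f-defined {3 + r} {B} {P} (subst (0 <_) (sym (φ-at r B 2 p₊≡2)) (m<n⇒0<n∸m gap))
              (subst (λ p → P (shift p (2 + r) B)) (sym p₊≡2) post)
    where
    p₊≡2 = p₊-column₂ r B lt
    gap : B 1 (3 + r) + 0 < B 1 (2 + r) + (B 2 (2 + r) + 0)
    gap = subst₂ _<_ (sym (+-identityʳ _)) (cong (B 1 (2 + r) +_) (sym (+-identityʳ _))) (<-≤-trans lt (m≤n+m _ _))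

  f-shifts-column₁ : ∀ r B {P : Arr → Set} → B 2 (2 + r) ≤ B 1 (3 + r) → 0 < B 1 (2 + r) →
                     P (shift 1 (2 + r) B) → Any P (f (3 + r) B)
  f-shifts-column₁ r B {P} le pos post =
    f-defined {3 + r} {B} {P} (subst (0 <_) (sym (φ-at r B 1 p₊≡1)) (subst (0 <_) (sym (+-identityʳ _)) pos))
              (subst (λ p → P (shift p (2 + r) B)) (sym p₊≡1) post)
    where
    p₊≡1 = p₊-column₁ r B le

  -- Column 2 of the source row is moved first (p₊ = 2), then column 1 (p₊ = 1).
  hop : ∀ a b → Hop (a + (b + 0)) a b
  hop a b (suc zero) x (s≤s ())
  hop a b (suc (suc r)) x {B} _ src tgt =
    subst (Any _) (sym (fpow-+ (3 + r) a (b + 0) B))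
          (Any->>= (fpow-induction (3 + r) R₂ step₂ (b + 0) start₂)
                   λ {B₁} done₂ → fpow-induction (3 + r) R₁ step₁ a {B₁} (start₁ {B₁} done₂))
    where
    R₂ : ℕ → ℕ → Arr → Set
    R₂ u d B′ = row B′ (2 + r) ≡ (x + a , u) × row B′ (3 + r) ≡ (0 , d) × Frame (2 + r) (3 + r) B B′
    step₂ : ∀ u d {B′} → R₂ (suc u) d B′ → Any (R₂ u (suc d)) (f (3 + r) B′)
    step₂ u d {B′} (left , right , fr) =
      f-shifts-column₂ r B′ (subst₂ _<_ (sym (cong proj₁ right)) (sym (cong proj₂ left)) z<s)
        (let left′ , right′ = row-shift₂ (2 + r) B′ left right in
         left′ , right′ , λ q outside → trans (shift-frame 2 (2 + r) B′ q outside) (fr q outside))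
    start₂ : R₂ (b + 0) 0 B
    start₂ = trans src (cong (x + a ,_) (sym (+-identityʳ b))) , tgt , λ _ _ → refl
    R₁ : ℕ → ℕ → Arr → Set
    R₁ u d B′ = row B′ (2 + r) ≡ (u + x , 0) × row B′ (3 + r) ≡ (d , b) × Frame (2 + r) (3 + r) B B′
    step₁ : ∀ u d {B′} → R₁ (suc u) d B′ → Any (R₁ u (suc d)) (f (3 + r) B′)
    step₁ u d {B′} (left , right , fr) =
      f-shifts-column₁ r B′ (subst₂ _≤_ (sym (cong proj₂ left)) (sym (cong proj₁ right)) z≤n)
                            (subst (0 <_) (sym (cong proj₁ left)) z<s)
        (let left′ , right′ = row-shift₁ (2 + r) B′ left right in
         left′ , right′ , λ q outside → trans (shift-frame 1 (2 + r) B′ q outside) (fr q outside))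
    start₁ : ∀ {B₁} → R₂ 0 (b + 0) B₁ → R₁ a 0 B₁
    start₁ (left , right , fr) = trans left (cong (_, 0) (+-comm x a)) , trans right (cong (0 ,_) (+-identityʳ b)) , fr

  lower : Arr → Arr
  lower B = update (update B 1 2 suc) 2 2 pred

  row-lower : ∀ B {t u} → row B 2 ≡ (t , suc u) → row (lower B) 2 ≡ (suc t , u)
  row-lower B here =
    cong₂ _,_ (trans (update-other (update B 1 2 suc) 2 2 pred 1 2 (inj₁ λ ()))
                     (trans (update-same B 1 2 suc) (cong suc (cong proj₁ here))))
              (trans (update-same (update B 1 2 suc) 2 2 pred)
                     (cong pred (trans (update-other B 1 2 suc 2 2 (inj₁ λ ())) (cong proj₂ here))))

  lower-other : ∀ B q → q ≢ 2 → row (lower B) q ≡ row B q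
  lower-other B q q≢2 =
    cong₂ _,_ (trans (update-other (update B 1 2 suc) 2 2 pred 1 q (inj₂ q≢2))
                     (update-other B 1 2 suc 1 q (inj₂ q≢2)))
              (trans (update-other (update B 1 2 suc) 2 2 pred 2 q (inj₂ q≢2))
                     (update-other B 1 2 suc 2 q (inj₂ q≢2)))

  f₁-lowers : ∀ B {P : Arr → Set} → Empty 3 n B → 0 < B 2 2 → P (lower B) → Any P (f 1 B)
  f₁-lowers B {P} empty pos post =
    f-defined {1} {B} {P} (subst (0 <_) (sym φ≡) (subst (0 <_) (sym φ-value) pos))
              (subst (λ p → P (update (update B 1 p suc) 2 p pred)) (sym p₋≡2) post)
    where
    tail₁ : ∀ k → k ≤ n → Σ[ 3 ∙∙ k ] (λ j → B 1 j) ≡ 0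
    tail₁ k k≤n = Σ-zero λ j 3≤j j≤k → cong proj₁ (empty j 3≤j (≤-trans j≤k k≤n))
    tail₂ : Σ[ 3 ∙∙ n ] (λ j → B 2 j) ≡ 0
    tail₂ = Σ-zero λ j 3≤j j≤n → cong proj₂ (empty j 3≤j j≤n)
    U-two : U 1 B 2 ≡ B 1 2 + B 2 2
    U-two = cong₂ _+_ (+-identityʳ (B 1 2)) (trans (cong (B 2 2 +_) tail₂) (+-identityʳ (B 2 2)))
    U-low : ∀ j → 2 < j → j ≤ n → U 1 B j ≡ B 1 2
    U-low j 2<j j≤n =
      trans (cong₂ _+_ (trans (Σ-head (λ t → B 1 t) (<⇒≤ 2<j)) (cong (B 1 2 +_) (tail₁ j j≤n)))
                       (Σ-zero λ t j≤t t≤n → cong proj₂ (empty t (≤-trans 2<j j≤t) t≤n)))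
            (trans (+-identityʳ _) (+-identityʳ (B 1 2)))
    p₋≡2 : p₋ 1 B ≡ 2
    p₋≡2 = largestMaximizer-lo 2 n λ j 2<j j≤n →
             subst₂ _<_ (sym (U-low j 2<j j≤n)) (sym U-two) (m<m+n (B 1 2) pos)
    φ≡ : φ 1 B ≡ Σ[ 2 ∙∙ n ] (λ j → B 2 j) ∸ Σ[ 3 ∙∙ n ] (λ j → B 1 j)
    φ≡ = cong (λ p → Σ[ p ∙∙ n ] (λ j → B 2 j) ∸ Σ[ suc p ∙∙ n ] (λ j → B 1 j)) p₋≡2
    φ-value : Σ[ 2 ∙∙ n ] (λ j → B 2 j) ∸ Σ[ 3 ∙∙ n ] (λ j → B 1 j) ≡ B 2 2
    φ-value = trans (cong₂ _∸_ (cong (B 2 2 +_) tail₂) (tail₁ n ≤-refl)) (+-identityʳ (B 2 2))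

  -- The Dyck path that leaves column 1 at row ℓ.
  turn : ℕ → ℕ → ℕ × ℕ
  turn ℓ r = if r <ᵇ ℓ then (1 , suc r) else (2 , r)

  turn-before : ∀ {ℓ r} → r < ℓ → turn ℓ r ≡ (1 , suc r)
  turn-before r<ℓ = if-true (<⇒<ᵇ-true r<ℓ)

  turn-after : ∀ {ℓ r} → ℓ ≤ r → turn ℓ r ≡ (2 , r)
  turn-after ℓ≤r = if-false (≤⇒<ᵇ-false ℓ≤r)

  turn-step : ∀ ℓ r → Step (turn ℓ r) (turn ℓ (suc r))
  turn-step ℓ r with suc r <? ℓ | r <? ℓ
  ... | yes 1+r<ℓ | _      =
    subst₂ Step (sym (turn-before (<-trans (n<1+n r) 1+r<ℓ))) (sym (turn-before 1+r<ℓ)) (inj₁ (refl , refl))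
  ... | no 1+r≮ℓ | yes r<ℓ =
    subst₂ Step (sym (turn-before r<ℓ)) (sym (turn-after (≮⇒≥ 1+r≮ℓ))) (inj₂ (refl , refl))
  ... | no 1+r≮ℓ | no r≮ℓ  =
    subst₂ Step (sym (turn-after (≮⇒≥ r≮ℓ))) (sym (turn-after (≮⇒≥ 1+r≮ℓ))) (inj₁ (refl , refl))

  module _ (A : Arr) (inB : InB n 2 m A) where
    open Descent n 2 m A

    turn-bound : ∀ ℓ → 2 ≤ ℓ → ℓ ≤ n → Σ[ 2 ∙∙ ℓ ] (A 1) + Σ[ ℓ ∙∙ n ] (A 2) ≤ m
    turn-bound (suc k) (s≤s 1≤k) ℓ≤n =
      subst (_≤ m) weight-of-turn
            (proj₂ inB (turn (suc k)) (turn-before (s≤s 1≤k) , turn-after ℓ≤n , λ r _ _ → turn-step (suc k) r))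
      where
      weight-of-turn : Σ[ 1 ∙∙ n ] (λ r → at A (turn (suc k) r)) ≡
                       Σ[ 2 ∙∙ suc k ] (A 1) + Σ[ suc k ∙∙ n ] (A 2)
      weight-of-turn =
        trans (Σ-split _ (s≤s z≤n) (≤-trans (n≤1+n k) ℓ≤n))
              (cong₂ _+_ (trans (Σ-cong in-column₁) (Σ-shift 1 k (A 1))) (Σ-cong in-column₂))
        where
        in-column₁ : ∀ r → 1 ≤ r → r ≤ k → at A (turn (suc k) r) ≡ A 1 (suc r)
        in-column₁ r _ r≤k = cong (at A) (turn-before (s≤s r≤k))
        in-column₂ : ∀ r → suc k ≤ r → r ≤ n → at A (turn (suc k) r) ≡ A 2 r
        in-column₂ r k<r _ = cong (at A) (turn-after k<r)

    weight-Stage : ∀ ℓ {B} → 2 ≤ ℓ → ℓ ≤ n → Stage ℓ B →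
                   weight B ≡ Σ[ 2 ∙∙ ℓ ] (A 1) + Σ[ suc ℓ ∙∙ n ] (A 2)
    weight-Stage ℓ {B} 2≤ℓ ℓ≤n (src , empty , settled) =
      cong₂ _+_ (trans (+-identityʳ (B 1 2)) (cong proj₁ src))
                (trans (Σ-split _ (m≤n⇒m≤1+n 2≤ℓ) ℓ≤n)
                       (cong₂ _+_ (Σ-zero vacant) (Σ-cong λ q ℓ<q q≤n → cong proj₂ (settled q ℓ<q q≤n))))
      where
      vacant : ∀ q → 2 ≤ q → q ≤ ℓ → B 2 q ≡ 0
      vacant q 2≤q q≤ℓ with m≤n⇒m<n∨m≡n 2≤q
      ... | inj₂ refl = cong proj₂ src
      ... | inj₁ 2<q  = cong proj₂ (empty q 2<q q≤ℓ)

    D-loads : ∀ ℓ → 2 ≤ ℓ → ℓ ≤ n → ∀ {B} → Stage ℓ B → Any (Loaded ℓ) (D A ℓ B)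
    D-loads ℓ@(suc k) 2≤ℓ ℓ≤n {B} stage@(src , empty , settled) =
      Any-map (λ {B′} → loaded {B′}) (fpow-raises-diagonal (s≤s z≤n) (s≤s (s≤s z≤n)) (A 2 ℓ) bound)
      where
      S₁ = Σ[ 2 ∙∙ ℓ ] (A 1)
      S₂ = Σ[ suc ℓ ∙∙ n ] (A 2)
      bound : weight B + A 2 ℓ ≤ m
      bound = subst (_≤ m) (begin
                S₁ + Σ[ ℓ ∙∙ n ] (A 2) ≡⟨ cong (S₁ +_) (Σ-head (A 2) ℓ≤n) ⟩
                S₁ + (A 2 ℓ + S₂)      ≡⟨ cong (S₁ +_) (+-comm (A 2 ℓ) S₂) ⟩
                S₁ + (S₂ + A 2 ℓ)      ≡⟨ +-assoc S₁ S₂ (A 2 ℓ) ⟨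
                S₁ + S₂ + A 2 ℓ        ≡⟨ cong (_+ A 2 ℓ) (weight-Stage ℓ {B} 2≤ℓ ℓ≤n stage) ⟨
                weight B + A 2 ℓ       ∎) (turn-bound ℓ 2≤ℓ ℓ≤n)
        where open ≡-Reasoning
      loaded : ∀ {B′} → B′ 2 2 ≡ A 2 ℓ + B 2 2 × OffDiagonal B B′ → Loaded ℓ B′
      loaded (b , fr) =
        cong₂ _,_ (trans (fr 1 2 (inj₁ λ ())) (trans (cong proj₁ src) (Σ-last (A 1) 2≤ℓ)))
                  (trans b (trans (cong (A 2 ℓ +_) (cong proj₂ src)) (+-identityʳ (A 2 ℓ)))) ,
        (λ q 3≤q q≤ℓ → trans (OffDiagonal⇒row fr q (>⇒≢ 3≤q)) (empty q 3≤q q≤ℓ)) ,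
        (λ q ℓ<q q≤n → trans (OffDiagonal⇒row fr q (>⇒≢ (≤-<-trans 2≤ℓ ℓ<q))) (settled q ℓ<q q≤n))

    G-reaches-Stage : Any (Stage n) (G A zeroArr)
    G-reaches-Stage =
      Any->>= (fpow-raises-diagonal (s≤s z≤n) (s≤s (s≤s z≤n)) (d A) {zeroArr} bound)
              λ {B₀} (b , fr) → Any-map (λ (here , empty) → here , empty , λ q n<q q≤n → ⊥-elim (<⇒≱ n<q q≤n))
                                        (fpow-induction 1 R step (d A) {B₀} (start b fr))
      where
      bound : weight zeroArr + d A ≤ m
      bound = subst (λ w → w + d A ≤ m) (sym (Σ-zero {2} {n} λ _ _ _ → refl))
                    (≤-trans (m≤m+n (d A) _) (turn-bound n (s≤s (s≤s z≤n)) ≤-refl))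
      R : ℕ → ℕ → Arr → Set
      R u t B = row B 2 ≡ (t , u) × Empty 3 n B
      step : ∀ u t {B} → R (suc u) t B → Any (R u (suc t)) (f 1 B)
      step u t {B} (here , empty) =
        f₁-lowers B empty (subst (0 <_) (sym (cong proj₂ here)) z<s)
          (row-lower B here , λ q 3≤q q≤n → trans (lower-other B q (>⇒≢ 3≤q)) (empty q 3≤q q≤n))
      start : ∀ {B₀} → B₀ 2 2 ≡ d A + 0 → OffDiagonal zeroArr B₀ → R (d A) 0 B₀
      start b fr = cong₂ _,_ (fr 1 2 (inj₁ λ ())) (trans b (+-identityʳ (d A))) ,
                   λ q 3≤q _ → OffDiagonal⇒row fr q (>⇒≢ 3≤q)

    P-agrees : Any Agrees (P A zeroArr)
    P-agrees = Any->>= G-reaches-Stage λ st → Any->>= (descent ≤-two hop′ D-loads′ st) X₂-finishes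
      where
      ≤-two : 2 ≤ n
      ≤-two = s≤s (s≤s z≤n)
      hop′ : ∀ ℓ → 2 < ℓ → ℓ ≤ n → Hop (c A ℓ) (A 1 ℓ) (A 2 ℓ)
      hop′ ℓ _ _ = hop (A 1 ℓ) (A 2 ℓ)
      D-loads′ : ∀ ℓ → 2 < ℓ → ℓ ≤ n → ∀ {B} → Stage ℓ B → Any (Loaded ℓ) (D A ℓ B)
      D-loads′ ℓ 2<ℓ = D-loads ℓ (<⇒≤ 2<ℓ)
      X₂-finishes : ∀ {B} → Stage 2 B → Any Agrees (X A 2 B)
      X₂-finishes st =
        Any->>= (D-loads 2 ≤-refl ≤-two st) λ {B} (here , _ , settled) → just (agrees ≤-refl {B} here settled)

lemma4p1 : (n i m : ℕ) → 4 ≤ n → (i ≡ 1 ⊎ i ≡ 2) → 1 ≤ m →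
    (A : Arr) → InB n i m A →
    Σ Arr (λ B → Crystal.P n i m A zeroArr ≡ just B ×
      (∀ p q → InRange n i p q → B p q ≡ A p q))
lemma4p1 n .1 m 4≤n (inj₁ refl) _ A inB = Any⇒≡just (OneColumn.P-agrees n m A inB (≤-trans (s≤s z≤n) 4≤n))
lemma4p1 (suc (suc n′)) .2 m _ (inj₂ refl) _ A inB = Any⇒≡just (TwoColumns.P-agrees n′ m A inB)
lemma4p1 1 .2 m (s≤s ()) (inj₂ refl) _ A inB
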